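{- Let $G$ be a finite simple connected graph and let $\{F_1,\ldots,F_r\}$ be a partition of $E(G)$ coarser than the $\Theta^*$-partition. For each $i$ define $a_i:V(G/F_i)\to\mathbb{R}$ by $a_i(C)=\sum_{x\in V(C)}\deg(x)$ and $b_i:V(G/F_i)\to\mathbb{R}^+$ by $b_i(C)=|V(C)|$ for every connected component $C$ of $G\setminus F_i$ (degrees taken in $G$). Then $$DD(G)=\sum_{i=1}^r W(G/F_i,a_i,b_i).$$
   Context: The degree distance is $DD(G)=\sum_{\{u,v\}\subseteq V(G)}(\deg(u)+\deg(v))\,d_G(u,v)$, sum over unordered pairs of distinct vertices. For a connected graph $H$ with weights $a,b$, $W(H,a,b)=\sum_{\{u,v\}\subseteq V(H)}(a(u)b(v)+a(v)b(u))\,d_H(u,v)$. Two edges $u_1v_1$, $u_2v_2$ are in relation $\Theta$ if $d(u_1,u_2)+d(v_1,v_2)\neq d(u_1,v_2)+d(v_1,u_2)$; $\Theta^*$ is its transitive closure, whose classes form the $\Theta^*$-partition of $E(G)$. A partition of $E(G)$ is coarser than the $\Theta^*$-partition if each of its parts is a union of $\Theta^*$-classes. For $F\subseteq E(G)$, $G/F$ is the graph whose vertices are the connected components of $G\setminus F$, two components being adjacent if some vertex of one is adjacent in $G$ to some vertex of the other. -}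

module Defs where

open import Data.Nat using (ℕ; zero; suc; _+_; _*_; _≤ᵇ_; _<ᵇ_)
open import Data.Bool using (Bool; true; false; _∧_; _∨_; not; if_then_else_)
open import Data.Fin using (Fin; toℕ; _≟_)
open import Data.List using (List; map; allFin)
open import Data.Nat.ListAction using (sum)
open import Data.Bool.ListAction using (any; all)
open import Data.Product using (Σ; _×_; _,_; ∃)
open import Relation.Nullary using (¬_)
open import Relation.Nullary.Decidable using (⌊_⌋)
open import Relation.Binary.PropositionalEquality using (_≡_)
open import Relation.Binary.Construct.Closure.Transitive using (TransClosure)

sumFin : ∀ {n} → (Fin n → ℕ) → ℕ
sumFin {n} f = sum (map f (allFin n))

sumPairs : ∀ {n} → (Fin n → Fin n → ℕ) → ℕ
sumPairs f = sumFin λ x → sumFin λ y → if toℕ x <ᵇ toℕ y then f x y else 0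

countFin : ∀ {n} → (Fin n → Bool) → ℕ
countFin p = sumFin λ x → if p x then 1 else 0

record Graph (n : ℕ) : Set where
  field
    adj     : Fin n → Fin n → Bool
    adj-sym : ∀ u v → adj u v ≡ adj v u
    loopless : ∀ u → adj u u ≡ false
open Graph public

eqᵇ : ∀ {n} → Fin n → Fin n → Bool
eqᵇ u v = ⌊ u ≟ v ⌋

-- reachWithin base A k u v : there is a sequence u = w₀, …, w_j with
-- j ≤ k, base u w₀ and A w_{t} w_{t+1} for each step and w_j = v
-- (with base = equality this is "walk of length ≤ k in A").
reachWithin : ∀ {n} → (Fin n → Fin n → Bool) → (Fin n → Fin n → Bool) →
              ℕ → Fin n → Fin n → Bool
reachWithin base A zero    u v = base u v
reachWithin base A (suc k) u v =
  reachWithin base A k u v ∨ any (λ w → reachWithin base A k u w ∧ A w v) (allFin _)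

-- least k ≤ m with p k = true (returns m if there is none)
leastUpTo : (ℕ → Bool) → ℕ → ℕ
leastUpTo p zero    = zero
leastUpTo p (suc m) = if p 0 then 0 else suc (leastUpTo (λ k → p (suc k)) m)

-- shortest-path distance w.r.t. base relation and adjacency
-- (lengths of shortest paths in an n-vertex graph are ≤ n)
distW : ∀ {n} → (Fin n → Fin n → Bool) → (Fin n → Fin n → Bool) →
        Fin n → Fin n → ℕ
distW {n} base A u v = leastUpTo (λ k → reachWithin base A k u v) n

dist : ∀ {n} → Graph n → Fin n → Fin n → ℕ
dist G = distW eqᵇ (adj G)

Connected : ∀ {n} → Graph n → Set
Connected G = ∀ u v → ∃ λ k → reachWithin eqᵇ (adj G) k u v ≡ true

deg : ∀ {n} → Graph n → Fin n → ℕ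
deg G u = countFin (adj G u)

DD : ∀ {n} → Graph n → ℕ
DD G = sumPairs λ u v → (deg G u + deg G v) * dist G u v

Edge : ∀ {n} → Graph n → Set
Edge {n} G = Σ (Fin n × Fin n) λ { (u , v) → adj G u v ≡ true }

Θ : ∀ {n} (G : Graph n) → Edge G → Edge G → Set
Θ G ((u₁ , v₁) , _) ((u₂ , v₂) , _) =
  ¬ (dist G u₁ u₂ + dist G v₁ v₂ ≡ dist G u₁ v₂ + dist G v₁ u₂)

Θ* : ∀ {n} (G : Graph n) → Edge G → Edge G → Set
Θ* G = TransClosure (Θ G)

-- Edge partitions {F₁,…,F_r} given by a labelling  part u v : Fin r
-- of (unordered) vertex pairs; F_i = { uv ∈ E(G) | part u v = i }.

adjMinus : ∀ {n r} → Graph n → (Fin n → Fin n → Fin r) → Fin r →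
           Fin n → Fin n → Bool
adjMinus G part i u v = adj G u v ∧ not (eqᵇ (part u v) i)

sameComp : ∀ {n r} → Graph n → (Fin n → Fin n → Fin r) → Fin r →
           Fin n → Fin n → Bool
sameComp {n} G part i x y = reachWithin eqᵇ (adjMinus G part i) n x y

quotAdj : ∀ {n r} → Graph n → (Fin n → Fin n → Fin r) → Fin r →
          Fin n → Fin n → Bool
quotAdj G part i x y =
  not (sameComp G part i x y) ∧
  any (λ x' → any (λ y' → sameComp G part i x x' ∧ sameComp G part i y y' ∧ adj G x' y')
                  (allFin _)) (allFin _)

-- d_{G/F_i}(C_x , C_y), C_z the component of z in G \ F_i
quotDist : ∀ {n r} → Graph n → (Fin n → Fin n → Fin r) → Fin r →
           Fin n → Fin n → ℕ
quotDist G part i = distW (sameComp G part i) (quotAdj G part i)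

isRep : ∀ {n r} → Graph n → (Fin n → Fin n → Fin r) → Fin r → Fin n → Bool
isRep G part i x = all (λ z → not (sameComp G part i x z) ∨ (toℕ x ≤ᵇ toℕ z)) (allFin _)

aW : ∀ {n r} → Graph n → (Fin n → Fin n → Fin r) → Fin r → Fin n → ℕ
aW G part i x = sumFin λ z → if sameComp G part i x z then deg G z else 0

bW : ∀ {n r} → Graph n → (Fin n → Fin n → Fin r) → Fin r → Fin n → ℕ
bW G part i x = countFin (sameComp G part i x)

-- W(G/F_i, a_i, b_i): sum over unordered pairs of distinct components,
-- each component represented by its least vertex
Wquot : ∀ {n r} → Graph n → (Fin n → Fin n → Fin r) → Fin r → ℕ
Wquot G part i = sumPairs λ x y →
  if isRep G part i x ∧ isRep G part i y
  then (aW G part i x * bW G part i y + aW G part i y * bW G part i x)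
       * quotDist G part i x y
  else 0

module Submission where

-- Fix a part F_i.  Contracting the components of G \ F_i maps a walk of G onto a walk of G / F_i
-- that uses only its F_i-edges, so d_{G/F_i}(u,v) is at most the number c_i of F_i-edges on a
-- shortest u–v path P.  Conversely, consider the potential
--   Φ_i(t) = Σ_{xy ∈ P ∩ F_i} (d(x,t) − d(y,t)).
-- An edge ab outside F_i is not Θ-related to the edges of F_i, so Φ_i(a) = Φ_i(b).  For an edge
-- ab of F_i, the same reason lets the terms of P outside F_i join in, so Φ_i changes like the full
-- telescoping sum: Φ_i(b) − Φ_i(a) = (d(u,b) − d(u,a)) + (d(v,a) − d(v,b)) ≤ 2.  As
-- Φ_i(v) − Φ_i(u) = 2 c_i, this gives d_{G/F_i}(u,v) = c_i, hence d_G = Σ_i d_{G/F_i}.  Finally,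
-- grouping the pairs {u,v} by the components of u and v turns Σ (deg u + deg v) d_{G/F_i}(u,v)
-- into W(G/F_i, a_i, b_i).

open import Defs
open import Data.Bool using (Bool; true; false; T; _∧_; _∨_; not; if_then_else_)
open import Data.Bool.ListAction using (any; all)
open import Data.Bool.Properties using (T-≡; T-∧; T-∨; T?; ∧-comm)
open import Data.Fin using (Fin; toℕ; _≟_; fromℕ<; inject) renaming (zero to fzero; suc to fsuc)
import Data.Fin.Properties as Fin
open import Data.Fin.Properties using (any?; ¬∀⟶∃¬-smallest)
open import Data.Integer using (ℤ; 0ℤ)
import Data.Integer as ℤ
import Data.Integer.Properties as ℤ
open import Data.Integer.Tactic.RingSolver using (solve-∀)
open import Data.List using (allFin)
open import Data.List.Membership.Propositional using (lose)
open import Data.List.Membership.Propositional.Properties using (∈-allFin)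
open import Data.List.Properties using (map-tabulate)
import Data.List.Relation.Unary.All as All
open import Data.List.Relation.Unary.All.Properties using (all⁺; all⁻)
open import Data.List.Relation.Unary.Any using (satisfied)
open import Data.List.Relation.Unary.Any.Properties using (any⁺; any⁻)
open import Data.Nat using (ℕ; zero; suc; _+_; _*_; _≤_; _<_; z≤n; s≤s; _≤ᵇ_; _<ᵇ_)
import Data.Nat as ℕ
open import Data.Nat.ListAction using (sum)
open import Data.Nat.Properties hiding (_≟_)
open import Data.Nat.Tactic.RingSolver using () renaming (solve-∀ to ℕ-solve-∀)
open import Algebra.Properties.CommutativeMonoid.Sum +-0-commutativeMonoid as ∑
  using (∑-distrib-+; ∑-comm)
open import Algebra.Properties.Semiring.Sum +-*-semiring using (*-distribˡ-sum)
open import Data.Product using (∃; _×_; _,_; proj₁; proj₂)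
open import Data.Sum using (_⊎_; inj₁; inj₂)
open import Data.Unit using (⊤)
open import Function using (_∘_; id)
open import Function.Bundles using (module Equivalence)
import Relation.Binary.Construct.Closure.Transitive as TransClosure
open import Relation.Binary.PropositionalEquality
open import Relation.Nullary using (¬_; yes; no; contradiction)
open import Relation.Nullary.Decidable
  using (toWitness; fromWitness; fromWitnessFalse; ¬?; _×-dec_; decidable-stable)
open import Relation.Nullary.Reflects using (Reflects; ofʸ; ofⁿ)

open Equivalence using (to; from)

-- Booleans and finite sums

eqᵇ-reflects : ∀ {n} (u v : Fin n) → Reflects (u ≡ v) (eqᵇ u v)
eqᵇ-reflects u v with u ≟ v
... | yes u≡v = ofʸ u≡v
... | no  u≢v = ofⁿ u≢v

T-not⁺ : ∀ {b} → ¬ T b → T (not b)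
T-not⁺ {false} _  = _
T-not⁺ {true}  ¬b = ¬b _

T-not⁻ : ∀ {b} → T (not b) → ¬ T b
T-not⁻ {false} _ ()

any-allFin⁺ : ∀ {n} (p : Fin n → Bool) x → T (p x) → T (any p (allFin n))
any-allFin⁺ p x px = any⁺ p (lose (∈-allFin x) px)

any-allFin⁻ : ∀ {n} (p : Fin n → Bool) → T (any p (allFin n)) → ∃ λ x → T (p x)
any-allFin⁻ {n} p h = satisfied (any⁻ p (allFin n) h)

all-allFin⁺ : ∀ {n} (p : Fin n → Bool) → (∀ x → T (p x)) → T (all p (allFin n))
all-allFin⁺ {n} p px = all⁻ p (All.universal px (allFin n))

all-allFin⁻ : ∀ {n} (p : Fin n → Bool) → T (all p (allFin n)) → ∀ x → T (p x)
all-allFin⁻ {n} p h x = All.lookup (all⁺ p (allFin n) h) (∈-allFin x)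

when : Bool → ℕ → ℕ
when b m = if b then m else 0

when-0 : ∀ b → when b 0 ≡ 0
when-0 true  = refl
when-0 false = refl

when-T : ∀ {b} m → T b → when b m ≡ m
when-T {true} m _ = refl

when-¬T : ∀ {b} m → ¬ T b → when b m ≡ 0
when-¬T {false} m _  = refl
when-¬T {true}  m ¬b = contradiction _ ¬b

sumFin-suc : ∀ {n} (f : Fin (suc n) → ℕ) → sumFin f ≡ f fzero + sumFin (f ∘ fsuc)
sumFin-suc f = cong (λ xs → f fzero + sum xs)
  (trans (map-tabulate fsuc f) (sym (map-tabulate id (f ∘ fsuc))))

sumFin≡∑ : ∀ {n} (f : Fin n → ℕ) → sumFin f ≡ ∑.sum f
sumFin≡∑ {zero}  f = refl
sumFin≡∑ {suc n} f = trans (sumFin-suc f) (cong (f fzero +_) (sumFin≡∑ (f ∘ fsuc)))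

sumFin-cong : ∀ {n} {f g : Fin n → ℕ} → (∀ x → f x ≡ g x) → sumFin f ≡ sumFin g
sumFin-cong {f = f} {g} f≗g = begin
  sumFin f ≡⟨ sumFin≡∑ f ⟩
  ∑.sum f  ≡⟨ ∑.sum-cong-≗ f≗g ⟩
  ∑.sum g  ≡⟨ sumFin≡∑ g ⟨
  sumFin g ∎
  where open ≡-Reasoning

sumFin-+ : ∀ {n} (f g : Fin n → ℕ) → sumFin (λ x → f x + g x) ≡ sumFin f + sumFin g
sumFin-+ f g = begin
  sumFin (λ x → f x + g x)  ≡⟨ sumFin≡∑ (λ x → f x + g x) ⟩
  ∑.sum (λ x → f x + g x)   ≡⟨ ∑-distrib-+ f g ⟩
  ∑.sum f + ∑.sum g         ≡⟨ cong₂ _+_ (sumFin≡∑ f) (sumFin≡∑ g) ⟨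
  sumFin f + sumFin g       ∎
  where open ≡-Reasoning

sumFin-*ˡ : ∀ {n} c (f : Fin n → ℕ) → sumFin (λ x → c * f x) ≡ c * sumFin f
sumFin-*ˡ c f = begin
  sumFin (λ x → c * f x)  ≡⟨ sumFin≡∑ (λ x → c * f x) ⟩
  ∑.sum (λ x → c * f x)   ≡⟨ *-distribˡ-sum c f ⟨
  c * ∑.sum f             ≡⟨ cong (c *_) (sumFin≡∑ f) ⟨
  c * sumFin f            ∎
  where open ≡-Reasoning

sumFin-swap : ∀ {m n} (f : Fin m → Fin n → ℕ) →
  sumFin (λ x → sumFin (f x)) ≡ sumFin (λ y → sumFin (λ x → f x y))
sumFin-swap f = begin
  sumFin (λ x → sumFin (f x))          ≡⟨ sumFin≡∑ (λ x → sumFin (f x)) ⟩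
  ∑.sum (λ x → sumFin (f x))           ≡⟨ ∑.sum-cong-≗ (λ x → sumFin≡∑ (f x)) ⟩
  ∑.sum (λ x → ∑.sum (f x))            ≡⟨ ∑-comm f ⟩
  ∑.sum (λ y → ∑.sum (λ x → f x y))    ≡⟨ ∑.sum-cong-≗ (λ y → sumFin≡∑ (λ x → f x y)) ⟨
  ∑.sum (λ y → sumFin (λ x → f x y))   ≡⟨ sumFin≡∑ (λ y → sumFin (λ x → f x y)) ⟨
  sumFin (λ y → sumFin (λ x → f x y))  ∎
  where open ≡-Reasoning

sumFin-zero : ∀ {n} (f : Fin n → ℕ) → (∀ x → f x ≡ 0) → sumFin f ≡ 0
sumFin-zero {zero}  f f≗0 = refl
sumFin-zero {suc n} f f≗0 =
  trans (sumFin-suc f) (cong₂ _+_ (f≗0 fzero) (sumFin-zero (f ∘ fsuc) (f≗0 ∘ fsuc)))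

sumFin-when : ∀ {n} b (f : Fin n → ℕ) → sumFin (λ x → when b (f x)) ≡ when b (sumFin f)
sumFin-when     true  f = refl
sumFin-when {n} false f = sumFin-zero {n} (λ _ → 0) (λ _ → refl)

sumFin-*ʳ : ∀ {n} c (f : Fin n → ℕ) → sumFin (λ x → f x * c) ≡ sumFin f * c
sumFin-*ʳ c f =
  trans (sumFin-cong (λ x → *-comm (f x) c)) (trans (sumFin-*ˡ c f) (*-comm c (sumFin f)))

sumFin-single : ∀ {n} (f : Fin n → ℕ) j → (∀ x → x ≢ j → f x ≡ 0) → sumFin f ≡ f j
sumFin-single {suc n} f fzero others = begin
  sumFin f                     ≡⟨ sumFin-suc f ⟩
  f fzero + sumFin (f ∘ fsuc)  ≡⟨ cong (f fzero +_) (sumFin-zero (f ∘ fsuc) (λ x → others (fsuc x) λ ())) ⟩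
  f fzero + 0                  ≡⟨ +-identityʳ (f fzero) ⟩
  f fzero                      ∎
  where open ≡-Reasoning
sumFin-single {suc n} f (fsuc j) others = begin
  sumFin f                     ≡⟨ sumFin-suc f ⟩
  f fzero + sumFin (f ∘ fsuc)  ≡⟨ cong (_+ sumFin (f ∘ fsuc)) (others fzero λ ()) ⟩
  sumFin (f ∘ fsuc)            ≡⟨ sumFin-single (f ∘ fsuc) j (λ x x≢j → others (fsuc x) (x≢j ∘ Fin.suc-injective)) ⟩
  f (fsuc j)                   ∎
  where open ≡-Reasoning

sumFin-δ : ∀ {n} (j : Fin n) → sumFin (λ i → when (eqᵇ j i) 1) ≡ 1
sumFin-δ j = trans (sumFin-single _ j i≢j⇒0) (δ-diag j)
  where
  i≢j⇒0 : ∀ i → i ≢ j → when (eqᵇ j i) 1 ≡ 0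
  i≢j⇒0 i i≢j with eqᵇ j i | eqᵇ-reflects j i
  ... | true  | ofʸ j≡i = contradiction (sym j≡i) i≢j
  ... | false | _       = refl
  δ-diag : ∀ j → when (eqᵇ j j) 1 ≡ 1
  δ-diag j with eqᵇ j j | eqᵇ-reflects j j
  ... | true  | _       = refl
  ... | false | ofⁿ j≢j = contradiction refl j≢j

sumFin-mono-≤ : ∀ {n} {f g : Fin n → ℕ} → (∀ x → f x ≤ g x) → sumFin f ≤ sumFin g
sumFin-mono-≤ {zero}          f≤g = z≤n
sumFin-mono-≤ {suc n} {f} {g} f≤g = begin
  sumFin f                     ≡⟨ sumFin-suc f ⟩
  f fzero + sumFin (f ∘ fsuc)  ≤⟨ +-mono-≤ (f≤g fzero) (sumFin-mono-≤ (f≤g ∘ fsuc)) ⟩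
  g fzero + sumFin (g ∘ fsuc)  ≡⟨ sumFin-suc g ⟨
  sumFin g                     ∎
  where open ≤-Reasoning

sumFin-mono-< : ∀ {n} {f g : Fin n → ℕ} → (∀ x → f x ≤ g x) → ∀ y → f y < g y →
                sumFin f < sumFin g
sumFin-mono-< {suc n} {f} {g} f≤g y fy<gy = begin-strict
  sumFin f                     ≡⟨ sumFin-suc f ⟩
  f fzero + sumFin (f ∘ fsuc)  <⟨ head-or-tail y fy<gy ⟩
  g fzero + sumFin (g ∘ fsuc)  ≡⟨ sumFin-suc g ⟨
  sumFin g                     ∎
  where
  open ≤-Reasoning
  head-or-tail : ∀ y → f y < g y → f fzero + sumFin (f ∘ fsuc) < g fzero + sumFin (g ∘ fsuc)
  head-or-tail fzero    lt = +-mono-<-≤ lt (sumFin-mono-≤ (f≤g ∘ fsuc))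
  head-or-tail (fsuc y) lt = +-mono-≤-< (f≤g fzero) (sumFin-mono-< (f≤g ∘ fsuc) y lt)

countFin-≤ : ∀ {n} (p : Fin n → Bool) → countFin p ≤ n
countFin-≤ {zero}  p = z≤n
countFin-≤ {suc n} p = begin
  countFin p
    ≡⟨ sumFin-suc (λ x → when (p x) 1) ⟩
  when (p fzero) 1 + countFin (p ∘ fsuc)
    ≤⟨ +-mono-≤ (indicator-≤1 (p fzero)) (countFin-≤ (p ∘ fsuc)) ⟩
  suc n
    ∎
  where
  open ≤-Reasoning
  indicator-≤1 : ∀ b → when b 1 ≤ 1
  indicator-≤1 true  = ≤-refl
  indicator-≤1 false = z≤n

countFin-⊂ : ∀ {n} {p q : Fin n → Bool} → (∀ x → T (p x) → T (q x)) →
             ∀ y → T (q y) → ¬ T (p y) → countFin p < countFin q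
countFin-⊂ p⊆q y qy ¬py = sumFin-mono-< (λ x → indicator-mono (p⊆q x)) y (indicator-< qy ¬py)
  where
  indicator-mono : ∀ {a b} → (T a → T b) → when a 1 ≤ when b 1
  indicator-mono {false}         _   = z≤n
  indicator-mono {true}  {true}  _   = ≤-refl
  indicator-mono {true}  {false} a⇒b = contradiction (a⇒b _) λ ()
  indicator-< : ∀ {a b} → T b → ¬ T a → when a 1 < when b 1
  indicator-< {false} {true} _ _  = s≤s z≤n
  indicator-< {true}         _ ¬a = contradiction _ ¬a

sumPairs-cong : ∀ {n} {f g : Fin n → Fin n → ℕ} → (∀ x y → f x y ≡ g x y) →
                sumPairs f ≡ sumPairs g
sumPairs-cong f≗g = sumFin-cong λ x → sumFin-cong λ y →
  cong (when (toℕ x <ᵇ toℕ y)) (f≗g x y)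

sumPairs-sumFin : ∀ {n r} (F : Fin r → Fin n → Fin n → ℕ) →
  sumPairs (λ u v → sumFin (λ i → F i u v)) ≡ sumFin (λ i → sumPairs (F i))
sumPairs-sumFin {n} {r} F = begin
  sumFin (λ x → sumFin (λ y → when (x ≺ y) (sumFin (λ i → F i x y))))
    ≡⟨ sumFin-cong (λ x → sumFin-cong λ y → sumFin-when (x ≺ y) (λ i → F i x y)) ⟨
  sumFin (λ x → sumFin (λ y → sumFin (λ i → when (x ≺ y) (F i x y))))
    ≡⟨ sumFin-cong (λ x → sumFin-swap (λ y i → when (x ≺ y) (F i x y))) ⟩
  sumFin (λ x → sumFin (λ i → sumFin (λ y → when (x ≺ y) (F i x y))))
    ≡⟨ sumFin-swap (λ x i → sumFin (λ y → when (x ≺ y) (F i x y))) ⟩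
  sumFin (λ i → sumPairs (F i))
    ∎
  where
  open ≡-Reasoning
  _≺_ : Fin n → Fin n → Bool
  x ≺ y = toℕ x <ᵇ toℕ y

sumFin²≡sumPairs+sumPairs : ∀ {n} (f : Fin n → Fin n → ℕ) →
  (∀ x y → f x y ≡ f y x) → (∀ x → f x x ≡ 0) →
  sumFin (λ x → sumFin (f x)) ≡ sumPairs f + sumPairs f
sumFin²≡sumPairs+sumPairs {n} f f-sym f-diag = begin
  sumFin (λ x → sumFin (f x))
    ≡⟨ sumFin-cong (λ x → trans (sumFin-cong (split x))
                               (sumFin-+ (λ y → when (x ≺ y) (f x y)) (λ y → when (y ≺ x) (f x y)))) ⟩
  sumFin (λ x → sumFin (λ y → when (x ≺ y) (f x y)) + sumFin (λ y → when (y ≺ x) (f x y)))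
    ≡⟨ sumFin-+ (λ x → sumFin (λ y → when (x ≺ y) (f x y)))
               (λ x → sumFin (λ y → when (y ≺ x) (f x y))) ⟩
  sumPairs f + sumFin (λ x → sumFin (λ y → when (y ≺ x) (f x y)))
    ≡⟨ cong (sumPairs f +_) (sumFin-swap (λ x y → when (y ≺ x) (f x y))) ⟩
  sumPairs f + sumFin (λ y → sumFin (λ x → when (y ≺ x) (f x y)))
    ≡⟨ cong (sumPairs f +_) (sumPairs-cong (λ y x → f-sym x y)) ⟩
  sumPairs f + sumPairs f
    ∎
  where
  open ≡-Reasoning
  _≺_ : Fin n → Fin n → Bool
  x ≺ y = toℕ x <ᵇ toℕ y
  split : ∀ x y → f x y ≡ when (x ≺ y) (f x y) + when (y ≺ x) (f x y)
  split x y with toℕ x <ᵇ toℕ y | <ᵇ-reflects-< (toℕ x) (toℕ y)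
               | toℕ y <ᵇ toℕ x | <ᵇ-reflects-< (toℕ y) (toℕ x)
  ... | true  | ofʸ x<y | true  | ofʸ y<x = contradiction y<x (<-asym x<y)
  ... | true  | _       | false | _       = sym (+-identityʳ (f x y))
  ... | false | _       | true  | _       = refl
  ... | false | ofⁿ x≮y | false | ofⁿ y≮x
    rewrite Fin.toℕ-injective (≤-antisym (≮⇒≥ y≮x) (≮⇒≥ x≮y)) = f-diag y

sumPairs-cong-sumFin² : ∀ {n} (f g : Fin n → Fin n → ℕ) →
  (∀ x y → f x y ≡ f y x) → (∀ x → f x x ≡ 0) →
  (∀ x y → g x y ≡ g y x) → (∀ x → g x x ≡ 0) →
  sumFin (λ x → sumFin (f x)) ≡ sumFin (λ x → sumFin (g x)) → sumPairs f ≡ sumPairs g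
sumPairs-cong-sumFin² f g f-sym f-diag g-sym g-diag ΣΣf≡ΣΣg = *-cancelˡ-≡ (sumPairs f) (sumPairs g) 2 (begin
  2 * sumPairs f              ≡⟨ cong (sumPairs f +_) (+-identityʳ (sumPairs f)) ⟩
  sumPairs f + sumPairs f     ≡⟨ sumFin²≡sumPairs+sumPairs f f-sym f-diag ⟨
  sumFin (λ x → sumFin (f x)) ≡⟨ ΣΣf≡ΣΣg ⟩
  sumFin (λ x → sumFin (g x)) ≡⟨ sumFin²≡sumPairs+sumPairs g g-sym g-diag ⟩
  sumPairs g + sumPairs g     ≡⟨ cong (sumPairs g +_) (+-identityʳ (sumPairs g)) ⟨
  2 * sumPairs g              ∎)
  where open ≡-Reasoning

-- Sums over the classes of an equivalence relation

module Classes {n : ℕ} (same : Fin n → Fin n → Bool)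
  (same-refl  : ∀ x → T (same x x))
  (same-sym   : ∀ {x y} → T (same x y) → T (same y x))
  (same-trans : ∀ {x y z} → T (same x y) → T (same y z) → T (same x z))
  where

  -- With same = sameComp G part i this is isRep G part i.
  isLeast : Fin n → Bool
  isLeast x = all (λ z → not (same x z) ∨ (toℕ x ≤ᵇ toℕ z)) (allFin n)

  classSum : (Fin n → ℕ) → Fin n → ℕ
  classSum f x = sumFin (λ u → when (same x u) (f u))

  isLeast-≤ : ∀ {x z} → T (isLeast x) → T (same x z) → toℕ x ≤ toℕ z
  isLeast-≤ {x} {z} least xz with to T-∨ (all-allFin⁻ _ least z)
  ... | inj₁ ¬xz = contradiction xz (T-not⁻ ¬xz)
  ... | inj₂ x≤z = ≤ᵇ⇒≤ (toℕ x) (toℕ z) x≤z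

  isLeast-unique : ∀ {x y u} → T (isLeast x) → T (isLeast y) → T (same x u) → T (same y u) → x ≡ y
  isLeast-unique least-x least-y xu yu = Fin.toℕ-injective (≤-antisym
    (isLeast-≤ least-x (same-trans xu (same-sym yu)))
    (isLeast-≤ least-y (same-trans yu (same-sym xu))))

  isLeast-exists : ∀ u → ∃ λ x → T (isLeast x) × T (same x u)
  isLeast-exists u
    with ¬∀⟶∃¬-smallest n (λ z → ¬ T (same u z)) (λ z → ¬? (T? (same u z)))
                          (λ outside → outside u (same-refl u))
  ... | x , ¬¬ux , smaller-outside = x , all-allFin⁺ _ least , same-sym ux
    where
    ux : T (same u x)
    ux = decidable-stable (T? (same u x)) ¬¬ux
    least : ∀ z → T (not (same x z) ∨ (toℕ x ≤ᵇ toℕ z))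
    least z with T? (same x z)
    ... | no  ¬xz = from T-∨ (inj₁ (T-not⁺ ¬xz))
    ... | yes xz  = from T-∨ (inj₂ (≤⇒≤ᵇ (≮⇒≥ λ z<x → smaller-outside (fromℕ< z<x)
            (subst (T ∘ same u) (sym (inject-fromℕ< z<x)) (same-trans ux xz)))))
      where
      inject-fromℕ< : ∀ {z x : Fin n} (z<x : toℕ z < toℕ x) → inject (fromℕ< z<x) ≡ z
      inject-fromℕ< z<x = Fin.toℕ-injective (trans (Fin.toℕ-inject (fromℕ< z<x)) (Fin.toℕ-fromℕ< z<x))

  sumFin-byClass : ∀ (f : Fin n → ℕ) → sumFin f ≡ sumFin (λ x → when (isLeast x) (classSum f x))
  sumFin-byClass f = begin
    sumFin f
      ≡⟨ sumFin-cong own-class ⟩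
    sumFin (λ u → sumFin (λ x → when (isLeast x) (when (same x u) (f u))))
      ≡⟨ sumFin-swap (λ u x → when (isLeast x) (when (same x u) (f u))) ⟩
    sumFin (λ x → sumFin (λ u → when (isLeast x) (when (same x u) (f u))))
      ≡⟨ sumFin-cong (λ x → sumFin-when (isLeast x) (λ u → when (same x u) (f u))) ⟩
    sumFin (λ x → when (isLeast x) (classSum f x))
      ∎
    where
    open ≡-Reasoning
    own-class : ∀ u → f u ≡ sumFin (λ x → when (isLeast x) (when (same x u) (f u)))
    own-class u with isLeast-exists u
    ... | x₀ , least₀ , x₀u = sym (trans (sumFin-single _ x₀ others)
                                         (trans (when-T _ least₀) (when-T (f u) x₀u)))
      where
      others : ∀ x → x ≢ x₀ → when (isLeast x) (when (same x u) (f u)) ≡ 0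
      others x x≢x₀ with T? (isLeast x) | T? (same x u)
      ... | no  ¬least | _      = when-¬T _ ¬least
      ... | yes least  | no ¬xu = trans (when-T _ least) (when-¬T (f u) ¬xu)
      ... | yes least  | yes xu = contradiction (isLeast-unique least least₀ xu x₀u) x≢x₀

  sumFin-byClass-* : ∀ (f φ : Fin n → ℕ) → (∀ {x u} → T (same x u) → φ x ≡ φ u) →
    sumFin (λ u → f u * φ u) ≡ sumFin (λ x → when (isLeast x) (classSum f x * φ x))
  sumFin-byClass-* f φ φ-invariant =
    trans (sumFin-byClass (λ u → f u * φ u)) (sumFin-cong (λ x → cong (when (isLeast x)) (factor x)))
    where
    factor : ∀ x → classSum (λ u → f u * φ u) x ≡ classSum f x * φ x
    factor x = trans (sumFin-cong pointwise) (sumFin-*ʳ (φ x) (λ u → when (same x u) (f u)))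
      where
      pointwise : ∀ u → when (same x u) (f u * φ u) ≡ when (same x u) (f u) * φ x
      pointwise u with T? (same x u)
      ... | yes xu = trans (when-T _ xu) (trans (cong (f u *_) (sym (φ-invariant xu)))
                                               (cong (_* φ x) (sym (when-T (f u) xu))))
      ... | no ¬xu = trans (when-¬T _ ¬xu) (cong (_* φ x) (sym (when-¬T (f u) ¬xu)))

  sumFin²-byClass : ∀ (f g : Fin n → ℕ) (q : Fin n → Fin n → ℕ) →
    (∀ {x u v} → T (same x u) → q x v ≡ q u v) → (∀ {u y v} → T (same y v) → q u y ≡ q u v) →
    sumFin (λ u → sumFin (λ v → f u * g v * q u v)) ≡
    sumFin (λ x → sumFin (λ y → when (isLeast x ∧ isLeast y) (classSum f x * classSum g y * q x y)))
  sumFin²-byClass f g q q-invariantˡ q-invariantʳ = begin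
    sumFin (λ u → sumFin (λ v → f u * g v * q u v))
      ≡⟨ sumFin-cong (λ u → trans (sumFin-cong (λ v → *-assoc (f u) (g v) (q u v)))
                                  (sumFin-*ˡ (f u) (λ v → g v * q u v))) ⟩
    sumFin (λ u → f u * sumFin (λ v → g v * q u v))
      ≡⟨ sumFin-byClass-* f (λ u → sumFin (λ v → g v * q u v))
                            (λ xu → sumFin-cong (λ v → cong (g v *_) (q-invariantˡ xu))) ⟩
    sumFin (λ x → when (isLeast x) (classSum f x * sumFin (λ v → g v * q x v)))
      ≡⟨ sumFin-cong (λ x → cong (λ s → when (isLeast x) (classSum f x * s))
                                 (sumFin-byClass-* g (q x) q-invariantʳ)) ⟩
    sumFin (λ x → when (isLeast x) (classSum f x * sumFin (λ y → when (isLeast y) (classSum g y * q x y))))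
      ≡⟨ sumFin-cong distribute ⟩
    sumFin (λ x → sumFin (λ y → when (isLeast x ∧ isLeast y) (classSum f x * classSum g y * q x y)))
      ∎
    where
    open ≡-Reasoning
    distribute : ∀ x → when (isLeast x) (classSum f x * sumFin (λ y → when (isLeast y) (classSum g y * q x y)))
                     ≡ sumFin (λ y → when (isLeast x ∧ isLeast y) (classSum f x * classSum g y * q x y))
    distribute x with isLeast x
    ... | false = sym (sumFin-zero {n} (λ _ → 0) (λ _ → refl))
    ... | true  = trans (sym (sumFin-*ˡ (classSum f x) (λ y → when (isLeast y) (classSum g y * q x y))))
                        (sumFin-cong pointwise)
      where
      pointwise : ∀ y → classSum f x * when (isLeast y) (classSum g y * q x y)
                      ≡ when (isLeast y) (classSum f x * classSum g y * q x y)
      pointwise y with isLeast y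
      ... | true  = sym (*-assoc (classSum f x) (classSum g y) (q x y))
      ... | false = *-zeroʳ (classSum f x)

  sumFin²-byClass-sym : ∀ (f g : Fin n → ℕ) (q : Fin n → Fin n → ℕ) →
    (∀ {x u v} → T (same x u) → q x v ≡ q u v) → (∀ {u y v} → T (same y v) → q u y ≡ q u v) →
    sumFin (λ u → sumFin (λ v → (f u * g v + f v * g u) * q u v)) ≡
    sumFin (λ x → sumFin (λ y → when (isLeast x ∧ isLeast y)
      ((classSum f x * classSum g y + classSum f y * classSum g x) * q x y)))
  sumFin²-byClass-sym f g q q-invariantˡ q-invariantʳ = begin
    sumFin (λ u → sumFin (λ v → (f u * g v + f v * g u) * q u v))
      ≡⟨ sumFin-cong (λ u → sumFin-cong (λ v → split (f u) (g v) (f v) (g u) (q u v))) ⟩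
    sumFin (λ u → sumFin (λ v → f u * g v * q u v + g u * f v * q u v))
      ≡⟨ sumFin²-+ (λ u v → f u * g v * q u v) (λ u v → g u * f v * q u v) ⟩
    sumFin (λ u → sumFin (λ v → f u * g v * q u v)) + sumFin (λ u → sumFin (λ v → g u * f v * q u v))
      ≡⟨ cong₂ _+_ (sumFin²-byClass f g q q-invariantˡ q-invariantʳ)
                   (sumFin²-byClass g f q q-invariantˡ q-invariantʳ) ⟩
    sumFin (λ x → sumFin (λ y → when (isLeast x ∧ isLeast y) (F x * G y * q x y))) +
    sumFin (λ x → sumFin (λ y → when (isLeast x ∧ isLeast y) (G x * F y * q x y)))
      ≡⟨ sumFin²-+ (λ x y → when (isLeast x ∧ isLeast y) (F x * G y * q x y))
                   (λ x y → when (isLeast x ∧ isLeast y) (G x * F y * q x y)) ⟨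
    sumFin (λ x → sumFin (λ y → when (isLeast x ∧ isLeast y) (F x * G y * q x y) +
                                when (isLeast x ∧ isLeast y) (G x * F y * q x y)))
      ≡⟨ sumFin-cong (λ x → sumFin-cong λ y →
           merge (isLeast x ∧ isLeast y) (F x) (G y) (F y) (G x) (q x y)) ⟩
    sumFin (λ x → sumFin (λ y → when (isLeast x ∧ isLeast y) ((F x * G y + F y * G x) * q x y)))
      ∎
    where
    open ≡-Reasoning
    F G : Fin n → ℕ
    F = classSum f
    G = classSum g
    sumFin²-+ : ∀ (h k : Fin n → Fin n → ℕ) →
      sumFin (λ u → sumFin (λ v → h u v + k u v))
        ≡ sumFin (λ u → sumFin (h u)) + sumFin (λ u → sumFin (k u))
    sumFin²-+ h k = trans (sumFin-cong (λ u → sumFin-+ (h u) (k u)))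
                          (sumFin-+ (λ u → sumFin (h u)) (λ u → sumFin (k u)))
    split : ∀ a b c e z → (a * b + c * e) * z ≡ a * b * z + e * c * z
    split = ℕ-solve-∀
    merged : ∀ a b a′ b′ z → a * b * z + b′ * a′ * z ≡ (a * b + a′ * b′) * z
    merged = ℕ-solve-∀
    merge : ∀ c a b a′ b′ z →
            when c (a * b * z) + when c (b′ * a′ * z) ≡ when c ((a * b + a′ * b′) * z)
    merge false a b a′ b′ z = refl
    merge true              = merged

-- Walks of bounded length

leastUpTo-≤ : ∀ (p : ℕ → Bool) m {k} → T (p k) → k ≤ m → leastUpTo p m ≤ k
leastUpTo-≤ p zero    pk k≤m = z≤n
leastUpTo-≤ p (suc m) {k} pk k≤m with p 0 in p0
... | true = z≤n
leastUpTo-≤ p (suc m) {zero}  pk k≤m       | false = contradiction (subst T p0 pk) λ ()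
leastUpTo-≤ p (suc m) {suc k} pk (s≤s k≤m) | false = s≤s (leastUpTo-≤ (p ∘ suc) m pk k≤m)

leastUpTo-satisfies : ∀ (p : ℕ → Bool) m {k} → T (p k) → k ≤ m → T (p (leastUpTo p m))
leastUpTo-satisfies p zero    {zero} pk k≤m = pk
leastUpTo-satisfies p (suc m) {k} pk k≤m with p 0 in p0
... | true = subst T (sym p0) _
leastUpTo-satisfies p (suc m) {zero}  pk k≤m       | false = contradiction (subst T p0 pk) λ ()
leastUpTo-satisfies p (suc m) {suc k} pk (s≤s k≤m) | false = leastUpTo-satisfies (p ∘ suc) m pk k≤m

module Walks {n : ℕ} (base A : Fin n → Fin n → Bool) where

  -- A walk of at most k A-steps, started by a zero-step walk between base-related vertices; the
  -- inductive reading of reachWithin base A k (base is equality in G and G \ F_i, sameComp in G / F_i).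
  infixl 5 _▸_
  data Walk≤ : ℕ → Fin n → Fin n → Set where
    [_] : ∀ {k u v} → T (base u v) → Walk≤ k u v
    _▸_ : ∀ {k u w v} → Walk≤ k u w → T (A w v) → Walk≤ (suc k) u v

  walk-suc : ∀ {k u v} → Walk≤ k u v → Walk≤ (suc k) u v
  walk-suc [ b ]   = [ b ]
  walk-suc (p ▸ a) = walk-suc p ▸ a

  walk-mono : ∀ {k m u v} → k ≤ m → Walk≤ k u v → Walk≤ m u v
  walk-mono _         [ b ]   = [ b ]
  walk-mono (s≤s k≤m) (p ▸ a) = walk-mono k≤m p ▸ a

  walk⇒reachWithin : ∀ {k u v} → Walk≤ k u v → T (reachWithin base A k u v)
  walk⇒reachWithin {zero}  [ b ]            = b
  walk⇒reachWithin {suc k} [ b ]            = from T-∨ (inj₁ (walk⇒reachWithin {k} [ b ]))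
  walk⇒reachWithin (_▸_ {w = w} p a) =
    from T-∨ (inj₂ (any-allFin⁺ _ w (from T-∧ (walk⇒reachWithin p , a))))

  reachWithin⇒walk : ∀ k {u v} → T (reachWithin base A k u v) → Walk≤ k u v
  reachWithin⇒walk zero    b = [ b ]
  reachWithin⇒walk (suc k) {u} {v} h with to T-∨ h
  ... | inj₁ shorter = walk-suc (reachWithin⇒walk k shorter)
  ... | inj₂ longer with any-allFin⁻ (λ w → reachWithin base A k u w ∧ A w v) longer
  ...   | w , last = reachWithin⇒walk k (proj₁ (to T-∧ last)) ▸ proj₂ (to T-∧ last)

  length : ∀ {k u v} → Walk≤ k u v → ℕ
  length [ _ ]   = 0
  length (p ▸ _) = suc (length p)

  countSteps : (Fin n → Fin n → Bool) → ∀ {k u v} → Walk≤ k u v → ℕ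
  countSteps P [ _ ]                     = 0
  countSteps P (_▸_ {w = w} {v = v} p _) = if P w v then suc (countSteps P p) else countSteps P p

  sumSteps : (Fin n → Fin n → ℤ) → ∀ {k u v} → Walk≤ k u v → ℤ
  sumSteps f [ _ ]                     = 0ℤ
  sumSteps f (_▸_ {w = w} {v = v} p _) = sumSteps f p ℤ.+ f w v

  AllSteps : (Fin n → Fin n → Set) → ∀ {k u v} → Walk≤ k u v → Set
  AllSteps P [ _ ]                     = ⊤
  AllSteps P (_▸_ {w = w} {v = v} p _) = AllSteps P p × P w v

  AllSteps-map : {P Q : Fin n → Fin n → Set} → (∀ {x y} → T (A x y) → P x y → Q x y) →
                 ∀ {k u v} (p : Walk≤ k u v) → AllSteps P p → AllSteps Q p
  AllSteps-map P⇒Q [ _ ]   _            = _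
  AllSteps-map P⇒Q (p ▸ a) (Pp , Pstep) = AllSteps-map P⇒Q p Pp , P⇒Q a Pstep

  allSteps : {P : Fin n → Fin n → Set} → (∀ {x y} → T (A x y) → P x y) →
             ∀ {k u v} (p : Walk≤ k u v) → AllSteps P p
  allSteps A⇒P [ _ ]   = _
  allSteps A⇒P (p ▸ a) = allSteps A⇒P p , A⇒P a

  sumSteps-cong : ∀ {f g : Fin n → Fin n → ℤ} {k u v} (p : Walk≤ k u v) →
                  AllSteps (λ x y → f x y ≡ g x y) p → sumSteps f p ≡ sumSteps g p
  sumSteps-cong [ _ ]   _            = refl
  sumSteps-cong (p ▸ _) (f≗g , f≡g) = cong₂ ℤ._+_ (sumSteps-cong p f≗g) f≡g

  sumSteps-0 : ∀ {k u v} (p : Walk≤ k u v) → sumSteps (λ _ _ → 0ℤ) p ≡ 0ℤ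
  sumSteps-0 [ _ ]   = refl
  sumSteps-0 (p ▸ _) = cong (ℤ._+ 0ℤ) (sumSteps-0 p)

  sumSteps-- : ∀ (f g : Fin n → Fin n → ℤ) {k u v} (p : Walk≤ k u v) →
               sumSteps (λ x y → f x y ℤ.- g x y) p ≡ sumSteps f p ℤ.- sumSteps g p
  sumSteps-- f g [ _ ] = refl
  sumSteps-- f g (_▸_ {w = w} {v = v} p _) = begin
    sumSteps (λ x y → f x y ℤ.- g x y) p ℤ.+ (f w v ℤ.- g w v)
      ≡⟨ cong (ℤ._+ (f w v ℤ.- g w v)) (sumSteps-- f g p) ⟩
    sumSteps f p ℤ.- sumSteps g p ℤ.+ (f w v ℤ.- g w v)
      ≡⟨ regroup (sumSteps f p) (sumSteps g p) (f w v) (g w v) ⟩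
    sumSteps f p ℤ.+ f w v ℤ.- (sumSteps g p ℤ.+ g w v)
      ∎
    where
    open ≡-Reasoning
    regroup : ∀ a b c d → a ℤ.- b ℤ.+ (c ℤ.- d) ≡ a ℤ.+ c ℤ.- (b ℤ.+ d)
    regroup = solve-∀

  sumSteps-telescope : ∀ (h : Fin n → ℤ) → (∀ {x y} → T (base x y) → h x ≡ h y) →
                       ∀ {k u v} (p : Walk≤ k u v) → sumSteps (λ x y → h x ℤ.- h y) p ≡ h u ℤ.- h v
  sumSteps-telescope h h-resp {u = u} [ b ] =
    sym (trans (cong (ℤ._-_ (h u)) (sym (h-resp b))) (ℤ.+-inverseʳ (h u)))
  sumSteps-telescope h h-resp {u = u} (_▸_ {w = w} {v = v} p _) = begin
    sumSteps (λ x y → h x ℤ.- h y) p ℤ.+ (h w ℤ.- h v)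
      ≡⟨ cong (ℤ._+ (h w ℤ.- h v)) (sumSteps-telescope h h-resp p) ⟩
    h u ℤ.- h w ℤ.+ (h w ℤ.- h v)
      ≡⟨ cancel (h u) (h w) (h v) ⟩
    h u ℤ.- h v
      ∎
    where
    open ≡-Reasoning
    cancel : ∀ a b c → a ℤ.- b ℤ.+ (b ℤ.- c) ≡ a ℤ.- c
    cancel = solve-∀

  sumSteps-indicator : ∀ (P : Fin n → Fin n → Bool) c {k u v} (p : Walk≤ k u v) →
    sumSteps (λ x y → if P x y then ℤ.+ c else 0ℤ) p ≡ ℤ.+ (c * countSteps P p)
  sumSteps-indicator P c [ _ ] = cong ℤ.+_ (sym (*-zeroʳ c))
  sumSteps-indicator P c (_▸_ {w = w} {v = v} p _) with P w v
  ... | false = trans (ℤ.+-identityʳ _) (sumSteps-indicator P c p)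
  ... | true  = begin
    sumSteps (λ x y → if P x y then ℤ.+ c else 0ℤ) p ℤ.+ ℤ.+ c
      ≡⟨ cong (ℤ._+ ℤ.+ c) (sumSteps-indicator P c p) ⟩
    ℤ.+ (c * countSteps P p) ℤ.+ ℤ.+ c
      ≡⟨ ℤ.pos-+ (c * countSteps P p) c ⟨
    ℤ.+ (c * countSteps P p + c)
      ≡⟨ cong ℤ.+_ (trans (+-comm _ c) (sym (*-suc c (countSteps P p)))) ⟩
    ℤ.+ (c * suc (countSteps P p))
      ∎
    where open ≡-Reasoning

  sumFin-countSteps : ∀ {r} (label : Fin n → Fin n → Fin r) {k u v} (p : Walk≤ k u v) →
    sumFin (λ i → countSteps (λ x y → eqᵇ (label x y) i) p) ≡ length p
  sumFin-countSteps {r} label [ _ ] = sumFin-zero {r} (λ _ → 0) (λ _ → refl)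
  sumFin-countSteps label (_▸_ {w = w} {v = v} p a) = begin
    sumFin (λ i → count i (p ▸ a))
      ≡⟨ sumFin-cong step ⟩
    sumFin (λ i → when (eqᵇ (label w v) i) 1 + count i p)
      ≡⟨ sumFin-+ (λ i → when (eqᵇ (label w v) i) 1) (λ i → count i p) ⟩
    sumFin (λ i → when (eqᵇ (label w v) i) 1) + sumFin (λ i → count i p)
      ≡⟨ cong₂ _+_ (sumFin-δ (label w v)) (sumFin-countSteps label p) ⟩
    suc (length p)
      ∎
    where
    open ≡-Reasoning
    count : ∀ i {k u v} → Walk≤ k u v → ℕ
    count i = countSteps (λ x y → eqᵇ (label x y) i)
    step : ∀ i → count i (p ▸ a) ≡ when (eqᵇ (label w v) i) 1 + count i p
    step i with eqᵇ (label w v) i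
    ... | true  = refl
    ... | false = refl

  -- Once the vertices reachable within k steps are all reachable within k+1 steps, no walk reaches
  -- further; the reachable sets can grow at most n times, so every walk can be replaced by one of n steps.
  module Saturation (u : Fin n) (base-uu : T (base u u)) where

    reached : ℕ → Fin n → Bool
    reached k = reachWithin base A k u

    Saturated : ℕ → Set
    Saturated k = ∀ {v} → Walk≤ (suc k) u v → Walk≤ k u v

    saturated-walk : ∀ {k m v} → Saturated k → Walk≤ m u v → Walk≤ k u v
    saturated-walk sat [ b ]   = [ b ]
    saturated-walk sat (p ▸ a) = sat (saturated-walk sat p ▸ a)

    saturated-or-grows : ∀ k → Saturated k ⊎ countFin (reached k) < countFin (reached (suc k))
    saturated-or-grows k with any? (λ v → T? (reached (suc k) v) ×-dec ¬? (T? (reached k v)))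
    ... | yes (v , new , ¬old) = inj₂ (countFin-⊂ (λ _ → reached-suc) v new ¬old)
      where
      reached-suc : ∀ {x} → T (reached k x) → T (reached (suc k) x)
      reached-suc = walk⇒reachWithin ∘ walk-suc ∘ reachWithin⇒walk k
    ... | no ¬new = inj₁ saturated
      where
      saturated : Saturated k
      saturated {v} p with T? (reached k v)
      ... | yes old = reachWithin⇒walk k old
      ... | no ¬old = contradiction (v , walk⇒reachWithin p , ¬old) ¬new

    saturated-within : ∀ m → (∃ λ k → k ≤ m × Saturated k) ⊎ m < countFin (reached m)
    saturated-within zero =
      inj₂ (subst (_< countFin (reached 0)) (sumFin-zero {n} (λ _ → 0) λ _ → refl)
                  (countFin-⊂ {p = λ _ → false} (λ _ ()) u base-uu id))
    saturated-within (suc m) with saturated-within m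
    ... | inj₁ (k , k≤m , sat) = inj₁ (k , m≤n⇒m≤1+n k≤m , sat)
    ... | inj₂ m<count with saturated-or-grows m
    ...   | inj₁ sat   = inj₁ (m , n≤1+n m , sat)
    ...   | inj₂ grows = inj₂ (≤-trans (s≤s m<count) grows)

    walk-within-n : ∀ {k v} → Walk≤ k u v → Walk≤ n u v
    walk-within-n p with saturated-within n
    ... | inj₁ (k , k≤n , sat) = walk-mono k≤n (saturated-walk sat p)
    ... | inj₂ n<count         = contradiction (countFin-≤ (reached n)) (<⇒≱ n<count)

  module Undirected
    (base-refl  : ∀ u → T (base u u))
    (base-sym   : ∀ {u v} → T (base u v) → T (base v u))
    (base-trans : ∀ {u v w} → T (base u v) → T (base v w) → T (base u w))
    (A-sym      : ∀ {u v} → T (A u v) → T (A v u))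
    (A-respʳ    : ∀ {w v v′} → T (A w v) → T (base v v′) → T (A w v′))
    where

    walk-within-n : ∀ {k u v} → Walk≤ k u v → Walk≤ n u v
    walk-within-n {u = u} = Saturation.walk-within-n u (base-refl u)

    walk-baseʳ : ∀ {k u w v} → Walk≤ k u w → T (base w v) → Walk≤ k u v
    walk-baseʳ [ b ]   b′ = [ base-trans b b′ ]
    walk-baseʳ (p ▸ a) b′ = p ▸ A-respʳ a b′

    walk-baseˡ : ∀ {k u u′ v} → T (base u u′) → Walk≤ k u′ v → Walk≤ k u v
    walk-baseˡ b [ b′ ]  = [ base-trans b b′ ]
    walk-baseˡ b (p ▸ a) = walk-baseˡ b p ▸ a

    walk-cons : ∀ {k u w v} → T (A u w) → Walk≤ k w v → Walk≤ (suc k) u v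
    walk-cons {u = u} a [ b ] = [ base-refl u ] ▸ A-respʳ a b
    walk-cons a (p ▸ a′)      = walk-cons a p ▸ a′

    walk-reverse : ∀ {k u v} → Walk≤ k u v → Walk≤ k v u
    walk-reverse [ b ]   = [ base-sym b ]
    walk-reverse (p ▸ a) = walk-cons (A-sym a) (walk-reverse p)

    walk-append : ∀ {j k u w v} → Walk≤ j u w → Walk≤ k w v → Walk≤ (j + k) u v
    walk-append {j} {k} p [ b ] = walk-mono (m≤m+n j k) (walk-baseʳ p b)
    walk-append {j} {suc k} {u} {v = v} p (q ▸ a) =
      subst (λ m → Walk≤ m u v) (sym (+-suc j k)) (walk-append p q ▸ a)

    distW-≤ : ∀ {k u v} → Walk≤ k u v → distW base A u v ≤ k
    distW-≤ {k} p with ≤-total k n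
    ... | inj₁ k≤n = leastUpTo-≤ _ n (walk⇒reachWithin p) k≤n
    ... | inj₂ n≤k = ≤-trans (leastUpTo-≤ _ n (walk⇒reachWithin (walk-within-n p)) ≤-refl) n≤k

    shortest-walk : ∀ {k u v} → Walk≤ k u v → Walk≤ (distW base A u v) u v
    shortest-walk {u = u} {v} p = reachWithin⇒walk _
      (leastUpTo-satisfies (λ k → reachWithin base A k u v) n (walk⇒reachWithin (walk-within-n p)) ≤-refl)

    distW-refl : ∀ u → distW base A u u ≡ 0
    distW-refl u = n≤0⇒n≡0 (distW-≤ {0} [ base-refl u ])

    distW-sym : ∀ {k u v} → Walk≤ k u v → distW base A u v ≡ distW base A v u
    distW-sym p = ≤-antisym (distW-≤ (walk-reverse (shortest-walk (walk-reverse p))))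
                            (distW-≤ (walk-reverse (shortest-walk p)))

    distW-respˡ : ∀ {k u u′ v} → T (base u u′) → Walk≤ k u′ v →
                  distW base A u v ≡ distW base A u′ v
    distW-respˡ b p = ≤-antisym (distW-≤ (walk-baseˡ b (shortest-walk p)))
                                (distW-≤ (walk-baseˡ (base-sym b) (shortest-walk (walk-baseˡ b p))))

    distW-triangle : ∀ {j k u w v} → Walk≤ j u w → Walk≤ k w v →
                     distW base A u v ≤ distW base A u w + distW base A w v
    distW-triangle p q = distW-≤ (walk-append (shortest-walk p) (shortest-walk q))

-- Distances in G

m+q≡o+n⇒m-n≡o-q : ∀ {m n o q} → m + q ≡ o + n → ℤ.+ m ℤ.- ℤ.+ n ≡ ℤ.+ o ℤ.- ℤ.+ q
m+q≡o+n⇒m-n≡o-q {m} {n} {o} {q} m+q≡o+n = begin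
  ℤ.+ m ℤ.- ℤ.+ n              ≡⟨ shift (ℤ.+ m) (ℤ.+ n) (ℤ.+ q) ⟩
  (ℤ.+ m ℤ.+ ℤ.+ q) ℤ.- n+q     ≡⟨ cong (ℤ._- n+q) (ℤ.pos-+ m q) ⟨
  ℤ.+ (m + q) ℤ.- n+q          ≡⟨ cong (λ z → ℤ.+ z ℤ.- n+q) m+q≡o+n ⟩
  ℤ.+ (o + n) ℤ.- n+q          ≡⟨ cong (ℤ._- n+q) (ℤ.pos-+ o n) ⟩
  (ℤ.+ o ℤ.+ ℤ.+ n) ℤ.- n+q     ≡⟨ cancel (ℤ.+ o) (ℤ.+ n) (ℤ.+ q) ⟩
  ℤ.+ o ℤ.- ℤ.+ q              ∎
  where
  open ≡-Reasoning
  n+q : ℤ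
  n+q = ℤ.+ n ℤ.+ ℤ.+ q
  shift : ∀ a b c → a ℤ.- b ≡ (a ℤ.+ c) ℤ.- (b ℤ.+ c)
  shift = solve-∀
  cancel : ∀ a b c → (a ℤ.+ b) ℤ.- (b ℤ.+ c) ≡ a ℤ.- c
  cancel = solve-∀

m≤n+k⇒m-n≤k : ∀ {m n k} → m ≤ n + k → ℤ.+ m ℤ.- ℤ.+ n ℤ.≤ ℤ.+ k
m≤n+k⇒m-n≤k {m} {n} {k} m≤n+k = begin
  ℤ.+ m ℤ.- ℤ.+ n            ≤⟨ ℤ.+-monoˡ-≤ (ℤ.- ℤ.+ n) (ℤ.+≤+ m≤n+k) ⟩
  ℤ.+ (n + k) ℤ.- ℤ.+ n      ≡⟨ cong (ℤ._- ℤ.+ n) (ℤ.pos-+ n k) ⟩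
  ℤ.+ n ℤ.+ ℤ.+ k ℤ.- ℤ.+ n  ≡⟨ cancel (ℤ.+ n) (ℤ.+ k) ⟩
  ℤ.+ k                      ∎
  where
  open ℤ.≤-Reasoning
  cancel : ∀ a b → a ℤ.+ b ℤ.- a ≡ b
  cancel = solve-∀

module GraphDistance {n : ℕ} (G : Graph n) (connected : Connected G) where

  open Walks eqᵇ (adj G) public
  open Undirected
    (λ u → fromWitness refl)
    (λ u≡v → fromWitness (sym (toWitness u≡v)))
    (λ u≡v v≡w → fromWitness (trans (toWitness u≡v) (toWitness v≡w)))
    (λ {u} {v} uv → subst T (adj-sym G u v) uv)
    (λ {w} wv v≡v′ → subst (T ∘ adj G w) (toWitness v≡v′) wv)
    public

  d : Fin n → Fin n → ℕ
  d = dist G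

  walk : ∀ u v → ∃ λ k → Walk≤ k u v
  walk u v = let k , reached = connected u v in k , reachWithin⇒walk k (from T-≡ reached)

  dist-sym : ∀ u v → d u v ≡ d v u
  dist-sym u v = distW-sym (proj₂ (walk u v))

  dist-triangle : ∀ u w v → d u v ≤ d u w + d w v
  dist-triangle u w v = distW-triangle (proj₂ (walk u w)) (proj₂ (walk w v))

  dist-adj : ∀ {u v} → T (adj G u v) → d u v ≡ 1
  dist-adj {u} {v} uv = ≤-antisym (distW-≤ edge) (n≢0⇒n>0 nonzero)
    where
    edge : Walk≤ 1 u v
    edge = [ fromWitness refl ] ▸ uv
    nonzero : d u v ≢ 0
    nonzero d≡0 with subst (λ k → Walk≤ k u v) d≡0 (shortest-walk edge)
    ... | [ u≡v ] rewrite toWitness u≡v = subst T (loopless G v) uv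

  dist-adj-≤ : ∀ {a b} s → T (adj G a b) → d s b ≤ suc (d s a)
  dist-adj-≤ {a} {b} s ab = begin
    d s b          ≤⟨ dist-triangle s a b ⟩
    d s a + d a b  ≡⟨ cong (d s a +_) (dist-adj ab) ⟩
    d s a + 1      ≡⟨ +-comm (d s a) 1 ⟩
    suc (d s a)    ∎
    where open ≤-Reasoning

  OnGeodesic : Fin n → Fin n → Fin n → Fin n → Set
  OnGeodesic u v x y = d u x + suc (d y v) ≡ d u v

  geodesic-extend : ∀ {u w v x y} → T (adj G x y) → T (adj G w v) → d u v ≡ suc (d u w) →
                    OnGeodesic u w x y → OnGeodesic u v x y
  geodesic-extend {u} {w} {v} {x} {y} xy wv duv on-uw = ≤-antisym shorter longer
    where
    open ≤-Reasoning
    shorter : d u x + suc (d y v) ≤ d u v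
    shorter = begin
      d u x + suc (d y v)        ≤⟨ +-monoʳ-≤ (d u x) (s≤s (dist-adj-≤ y wv)) ⟩
      d u x + suc (suc (d y w))  ≡⟨ +-suc (d u x) (suc (d y w)) ⟩
      suc (d u x + suc (d y w))  ≡⟨ cong suc on-uw ⟩
      suc (d u w)                ≡⟨ duv ⟨
      d u v                      ∎
    longer : d u v ≤ d u x + suc (d y v)
    longer = begin
      d u v                  ≤⟨ dist-triangle u x v ⟩
      d u x + d x v          ≤⟨ +-monoʳ-≤ (d u x) (dist-triangle x y v) ⟩
      d u x + (d x y + d y v) ≡⟨ cong (λ e → d u x + (e + d y v)) (dist-adj xy) ⟩
      d u x + suc (d y v)    ∎

  geodesic-steps : ∀ {k u v} (p : Walk≤ k u v) → d u v ≡ k → length p ≡ k × AllSteps (OnGeodesic u v) p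
  geodesic-steps {u = u} [ u≡v ] duv rewrite toWitness u≡v = trans (sym (distW-refl _)) duv , _
  geodesic-steps {suc k} {u} {v} (_▸_ {w = w} p wv) duv =
    cong suc length≡k , AllSteps-map (λ xy → geodesic-extend xy wv duv′) p on-uw , last-step
    where
    duw : d u w ≡ k
    duw = ≤-antisym (distW-≤ p) (≤-pred (subst (_≤ suc (d u w)) duv (dist-adj-≤ u wv)))
    duv′ : d u v ≡ suc (d u w)
    duv′ = trans duv (cong suc (sym duw))
    length≡k : length p ≡ k
    length≡k = proj₁ (geodesic-steps p duw)
    on-uw : AllSteps (OnGeodesic u w) p
    on-uw = proj₂ (geodesic-steps p duw)
    last-step : OnGeodesic u v w v
    last-step = trans (cong (λ e → d u w + suc e) (distW-refl v)) (trans (+-comm (d u w) 1) (sym duv′))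

  geodesic-step : ∀ {u v x y} → T (adj G x y) → OnGeodesic u v x y →
                  d u y ≡ suc (d u x) × d x v ≡ suc (d y v)
  geodesic-step {u} {v} {x} {y} xy on-uv = ≤-antisym uy≤ uy≥ , ≤-antisym xv≤ xv≥
    where
    open ≤-Reasoning
    uy≤ : d u y ≤ suc (d u x)
    uy≤ = dist-adj-≤ u xy
    uy≥ : suc (d u x) ≤ d u y
    uy≥ = +-cancelʳ-≤ (d y v) (suc (d u x)) (d u y) (begin
      suc (d u x) + d y v  ≡⟨ +-suc (d u x) (d y v) ⟨
      d u x + suc (d y v)  ≡⟨ on-uv ⟩
      d u v                ≤⟨ dist-triangle u y v ⟩
      d u y + d y v        ∎)
    xv≤ : d x v ≤ suc (d y v)
    xv≤ = begin
      d x v          ≤⟨ dist-triangle x y v ⟩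
      d x y + d y v  ≡⟨ cong (_+ d y v) (dist-adj xy) ⟩
      suc (d y v)    ∎
    xv≥ : suc (d y v) ≤ d x v
    xv≥ = +-cancelˡ-≤ (d u x) (suc (d y v)) (d x v) (begin
      d u x + suc (d y v)  ≡⟨ on-uv ⟩
      d u v                ≤⟨ dist-triangle u x v ⟩
      d u x + d x v        ∎)

  geodesic : ∀ u v → ∃ λ (p : Walk≤ (d u v) u v) → length p ≡ d u v × AllSteps (OnGeodesic u v) p
  geodesic u v = let p = shortest-walk (proj₂ (walk u v)) in p , geodesic-steps p refl

  dist-difference-adj : ∀ {s e a b} → T (adj G a b) →
    (ℤ.+ d s b ℤ.- ℤ.+ d e b) ℤ.- (ℤ.+ d s a ℤ.- ℤ.+ d e a) ℤ.≤ ℤ.+ 2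
  dist-difference-adj {s} {e} {a} {b} ab = begin
    (ℤ.+ d s b ℤ.- ℤ.+ d e b) ℤ.- (ℤ.+ d s a ℤ.- ℤ.+ d e a)
      ≡⟨ regroup (ℤ.+ d s b) (ℤ.+ d e b) (ℤ.+ d s a) (ℤ.+ d e a) ⟩
    (ℤ.+ d s b ℤ.+ ℤ.+ d e a) ℤ.- (ℤ.+ d s a ℤ.+ ℤ.+ d e b)
      ≡⟨ cong₂ ℤ._-_ (ℤ.pos-+ (d s b) (d e a)) (ℤ.pos-+ (d s a) (d e b)) ⟨
    ℤ.+ (d s b + d e a) ℤ.- ℤ.+ (d s a + d e b)
      ≤⟨ m≤n+k⇒m-n≤k moved-by-one-edge ⟩
    ℤ.+ 2
      ∎
    where
    open ℤ.≤-Reasoning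
    regroup : ∀ m n o q → (m ℤ.- n) ℤ.- (o ℤ.- q) ≡ (m ℤ.+ q) ℤ.- (o ℤ.+ n)
    regroup = solve-∀
    moved-by-one-edge : d s b + d e a ≤ d s a + d e b + 2
    moved-by-one-edge = ≤-trans (+-mono-≤ (dist-adj-≤ s ab) (dist-adj-≤ e (subst T (adj-sym G a b) ab)))
                                (≤-reflexive (shuffle (d s a) (d e b)))
      where
      shuffle : ∀ x y → suc x + suc y ≡ x + y + 2
      shuffle = ℕ-solve-∀

-- The quotients G / F_i

module EdgePartition {n r : ℕ} (G : Graph n) (connected : Connected G)
  (part : Fin n → Fin n → Fin r) (part-sym : ∀ u v → part u v ≡ part v u)
  (coarse : ∀ (e f : Edge G) → Θ* G e f →
    part (proj₁ (proj₁ e)) (proj₂ (proj₁ e)) ≡ part (proj₁ (proj₁ f)) (proj₂ (proj₁ f)))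
  where

  open GraphDistance G connected

  balanced-across-parts : ∀ {x y a b} → T (adj G x y) → T (adj G a b) → part x y ≢ part a b →
           d x a + d y b ≡ d x b + d y a
  balanced-across-parts {x} {y} {a} {b} xy ab parts≢ with d x a + d y b ℕ.≟ d x b + d y a
  ... | yes balanced = balanced
  ... | no  Θxy,ab   = contradiction
    (coarse ((x , y) , to T-≡ xy) ((a , b) , to T-≡ ab) TransClosure.[ Θxy,ab ]) parts≢

  gap : Fin n → Fin n → Fin n → ℤ
  gap x y t = ℤ.+ d x t ℤ.- ℤ.+ d y t

  gap-Θ : ∀ {x y a b} → T (adj G x y) → T (adj G a b) → part x y ≢ part a b →
          gap x y b ℤ.- gap x y a ≡ 0ℤ
  gap-Θ {x} {y} {a} {b} xy ab parts≢ = trans (cong (ℤ._-_ (gap x y b)) gap-a≡gap-b) (ℤ.+-inverseʳ (gap x y b))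
    where
    gap-a≡gap-b : gap x y a ≡ gap x y b
    gap-a≡gap-b = m+q≡o+n⇒m-n≡o-q {d x a} {d y a} {d x b} {d y b} (balanced-across-parts xy ab parts≢)

  gap-geodesic : ∀ {s e x y} → T (adj G x y) → OnGeodesic s e x y → gap x y e ℤ.- gap x y s ≡ ℤ.+ 2
  gap-geodesic {s} {e} {x} {y} xy on with geodesic-step xy on
  ... | sy≡1+sx , xe≡1+ye
    rewrite xe≡1+ye | dist-sym y s | sy≡1+sx | dist-sym x s
          | ℤ.pos-+ 1 (d y e) | ℤ.pos-+ 1 (d s x) = two (ℤ.+ d y e) (ℤ.+ d s x)
    where
    two : ∀ a b → (ℤ.+ 1 ℤ.+ a ℤ.- a) ℤ.- (b ℤ.- (ℤ.+ 1 ℤ.+ b)) ≡ ℤ.+ 2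
    two = solve-∀

  module Quotient (i : Fin r) where

    module Minus = Walks eqᵇ (adjMinus G part i)
    module MinusU = Minus.Undirected
      (λ u → fromWitness refl)
      (λ u≡v → fromWitness (sym (toWitness u≡v)))
      (λ u≡v v≡w → fromWitness (trans (toWitness u≡v) (toWitness v≡w)))
      (λ {u} {v} uv → subst T (cong₂ (λ a p → a ∧ not (eqᵇ p i)) (adj-sym G u v) (part-sym u v)) uv)
      (λ {w} wv v≡v′ → subst (T ∘ adjMinus G part i w) (toWitness v≡v′) wv)

    same : Fin n → Fin n → Bool
    same = sameComp G part i

    walk⇒same : ∀ {k x y} → Minus.Walk≤ k x y → T (same x y)
    walk⇒same = Minus.walk⇒reachWithin ∘ MinusU.walk-within-n

    same⇒walk : ∀ {x y} → T (same x y) → Minus.Walk≤ n x y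
    same⇒walk = Minus.reachWithin⇒walk n

    same-refl : ∀ x → T (same x x)
    same-refl x = walk⇒same {0} Minus.[ fromWitness refl ]

    same-sym : ∀ {x y} → T (same x y) → T (same y x)
    same-sym = walk⇒same ∘ MinusU.walk-reverse ∘ same⇒walk

    same-trans : ∀ {x y z} → T (same x y) → T (same y z) → T (same x z)
    same-trans xy yz = walk⇒same (MinusU.walk-append (same⇒walk xy) (same⇒walk yz))

    adj-outside⇒same : ∀ {x y} → T (adj G x y) → part x y ≢ i → T (same x y)
    adj-outside⇒same {x} xy ≢i =
      walk⇒same {1} (Minus.[ fromWitness refl ] Minus.▸ from T-∧ (xy , fromWitnessFalse ≢i))

    edgeBetween : Fin n → Fin n → Fin n → Fin n → Bool
    edgeBetween x y x′ y′ = same x x′ ∧ same y y′ ∧ adj G x′ y′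

    Linked : Fin n → Fin n → Set
    Linked x y = ∃ λ x′ → ∃ λ y′ → T (same x x′) × T (same y y′) × T (adj G x′ y′)

    quotAdj-intro : ∀ {x y} → ¬ T (same x y) → Linked x y → T (quotAdj G part i x y)
    quotAdj-intro {x} {y} ¬xy (x′ , y′ , xx′ , yy′ , x′y′) = from T-∧ (T-not⁺ ¬xy ,
      any-allFin⁺ _ x′ (any-allFin⁺ _ y′ (from T-∧ (xx′ , from T-∧ (yy′ , x′y′)))))

    quotAdj-elim : ∀ {x y} → T (quotAdj G part i x y) → ¬ T (same x y) × Linked x y
    quotAdj-elim {x} {y} xy with to T-∧ xy
    ... | ¬xy , linked with any-allFin⁻ (λ x′ → any (edgeBetween x y x′) (allFin n)) linked
    ... | x′ , linked′ with any-allFin⁻ (edgeBetween x y x′) linked′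
    ... | y′ , edge with to T-∧ edge
    ... | xx′ , rest = T-not⁻ ¬xy , x′ , y′ , xx′ , to T-∧ rest

    quotAdj-sym : ∀ {x y} → T (quotAdj G part i x y) → T (quotAdj G part i y x)
    quotAdj-sym xy with quotAdj-elim xy
    ... | ¬xy , x′ , y′ , xx′ , yy′ , x′y′ =
      quotAdj-intro (¬xy ∘ same-sym) (y′ , x′ , yy′ , xx′ , subst T (adj-sym G x′ y′) x′y′)

    quotAdj-respʳ : ∀ {x y y″} → T (quotAdj G part i x y) → T (same y y″) → T (quotAdj G part i x y″)
    quotAdj-respʳ xy yy″ with quotAdj-elim xy
    ... | ¬xy , x′ , y′ , xx′ , yy′ , x′y′ =
      quotAdj-intro (λ xy″ → ¬xy (same-trans xy″ (same-sym yy″)))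
                    (x′ , y′ , xx′ , same-trans (same-sym yy″) yy′ , x′y′)

    module Quot = Walks same (quotAdj G part i)
    module QuotU = Quot.Undirected same-refl same-sym same-trans quotAdj-sym quotAdj-respʳ

    inPart : Fin n → Fin n → Bool
    inPart x y = eqᵇ (part x y) i

    project : ∀ {k u v} (p : Walk≤ k u v) → Quot.Walk≤ (countSteps inPart p) u v
    project [ u≡v ] rewrite toWitness u≡v = Quot.[ same-refl _ ]
    project (_▸_ {w = w} {v = v} p wv) with inPart w v | eqᵇ-reflects (part w v) i
    ... | false | ofⁿ ≢i = QuotU.walk-baseʳ (project p) (adj-outside⇒same wv ≢i)
    ... | true  | _ with T? (same w v)
    ...   | yes joined = Quot.walk-suc (QuotU.walk-baseʳ (project p) joined)
    ...   | no  apart  = project p Quot.▸ quotAdj-intro apart (w , v , same-refl w , same-refl v , wv)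

    quotDist-≤-countSteps : ∀ {k u v} (p : Walk≤ k u v) → quotDist G part i u v ≤ countSteps inPart p
    quotDist-≤-countSteps p = QuotU.distW-≤ (project p)

    selectedGap : Fin n → Fin n → Fin n → ℤ
    selectedGap t x y = if inPart x y then gap x y t else 0ℤ

    selectedGap-change : ∀ {x y a b} → T (adj G x y) → T (adj G a b) →
      selectedGap b x y ℤ.- selectedGap a x y ≡ (if inPart a b then gap x y b ℤ.- gap x y a else 0ℤ)
    selectedGap-change {x} {y} {a} {b} xy ab
      with inPart x y | eqᵇ-reflects (part x y) i | inPart a b | eqᵇ-reflects (part a b) i
    ... | true  | _        | true  | _        = refl
    ... | false | _        | false | _        = refl
    ... | true  | ofʸ xy∈i | false | ofⁿ ab∉i = gap-Θ xy ab λ xy≡ab → ab∉i (trans (sym xy≡ab) xy∈i)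
    ... | false | ofⁿ xy∉i | true  | ofʸ ab∈i = sym (gap-Θ xy ab λ xy≡ab → xy∉i (trans xy≡ab ab∈i))

    module Potential {k s e} (p : Walk≤ k s e) where

      Φ : Fin n → ℤ
      Φ t = sumSteps (selectedGap t) p

      ψ : Fin n → ℤ
      ψ t = ℤ.+ d s t ℤ.- ℤ.+ d e t

      ψ-telescope : ∀ t → sumSteps (λ x y → gap x y t) p ≡ ψ t
      ψ-telescope t =
        sumSteps-telescope (λ x → ℤ.+ d x t) (λ x≡y → cong (λ z → ℤ.+ d z t) (toWitness x≡y)) p

      Φ-change : ∀ {a b} → T (adj G a b) → Φ b ℤ.- Φ a ≡ (if inPart a b then ψ b ℤ.- ψ a else 0ℤ)
      Φ-change {a} {b} ab = begin
        Φ b ℤ.- Φ a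
          ≡⟨ sumSteps-- (selectedGap b) (selectedGap a) p ⟨
        sumSteps (λ x y → selectedGap b x y ℤ.- selectedGap a x y) p
          ≡⟨ sumSteps-cong p (allSteps (λ xy → selectedGap-change xy ab) p) ⟩
        sumSteps (λ x y → if inPart a b then gap x y b ℤ.- gap x y a else 0ℤ) p
          ≡⟨ total-change ⟩
        (if inPart a b then ψ b ℤ.- ψ a else 0ℤ)
          ∎
        where
        open ≡-Reasoning
        total-change : sumSteps (λ x y → if inPart a b then gap x y b ℤ.- gap x y a else 0ℤ) p
                     ≡ (if inPart a b then ψ b ℤ.- ψ a else 0ℤ)
        total-change with inPart a b
        ... | true  = trans (sumSteps-- (λ x y → gap x y b) (λ x y → gap x y a) p)
                            (cong₂ ℤ._-_ (ψ-telescope b) (ψ-telescope a))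
        ... | false = sumSteps-0 p

      Φ-adj : ∀ {a b} → T (adj G a b) → Φ b ℤ.- Φ a ℤ.≤ ℤ.+ 2
      Φ-adj {a} {b} ab with inPart a b | Φ-change ab
      ... | true  | change    = ℤ.≤-trans (ℤ.≤-reflexive change) (dist-difference-adj ab)
      ... | false | no-change = ℤ.≤-trans (ℤ.≤-reflexive no-change) (ℤ.+≤+ z≤n)

      Φ-outside : ∀ {a b} → T (adj G a b) → ¬ T (inPart a b) → Φ a ≡ Φ b
      Φ-outside {a} {b} ab ∉i with inPart a b | Φ-change ab
      ... | true  | _         = contradiction _ ∉i
      ... | false | no-change = sym (ℤ.i-j≡0⇒i≡j (Φ b) (Φ a) no-change)

      Φ-minusWalk : ∀ {k a b} → Minus.Walk≤ k a b → Φ a ≡ Φ b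
      Φ-minusWalk Minus.[ a≡b ] = cong Φ (toWitness a≡b)
      Φ-minusWalk (q Minus.▸ wv) with to T-∧ wv
      ... | adj-wv , ∉i = trans (Φ-minusWalk q) (Φ-outside adj-wv (T-not⁻ ∉i))

      Φ-same : ∀ {a b} → T (same a b) → Φ a ≡ Φ b
      Φ-same = Φ-minusWalk ∘ same⇒walk

      Φ-quotWalk : ∀ {k a b} → Quot.Walk≤ k a b → Φ b ℤ.- Φ a ℤ.≤ ℤ.+ (2 * k)
      Φ-quotWalk {k} {a} {b} Quot.[ ab ] = begin
        Φ b ℤ.- Φ a  ≡⟨ cong (ℤ._- Φ a) (Φ-same ab) ⟨
        Φ a ℤ.- Φ a  ≡⟨ ℤ.+-inverseʳ (Φ a) ⟩
        0ℤ           ≤⟨ ℤ.+≤+ z≤n ⟩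
        ℤ.+ (2 * k)  ∎
        where open ℤ.≤-Reasoning
      Φ-quotWalk {suc k} {a} (Quot._▸_ {w = w} {v = v} q wv) with quotAdj-elim wv
      ... | _ , w′ , v′ , ww′ , vv′ , w′v′ = begin
        Φ v ℤ.- Φ a                          ≡⟨ split (Φ v) (Φ w) (Φ a) ⟩
        (Φ v ℤ.- Φ w) ℤ.+ (Φ w ℤ.- Φ a)      ≡⟨ cong₂ (λ y x → (y ℤ.- x) ℤ.+ _) (Φ-same vv′) (Φ-same ww′) ⟩
        (Φ v′ ℤ.- Φ w′) ℤ.+ (Φ w ℤ.- Φ a)    ≤⟨ ℤ.+-mono-≤ (Φ-adj w′v′) (Φ-quotWalk q) ⟩
        ℤ.+ 2 ℤ.+ ℤ.+ (2 * k)                ≡⟨ ℤ.pos-+ 2 (2 * k) ⟨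
        ℤ.+ (2 + 2 * k)                      ≡⟨ cong ℤ.+_ (*-suc 2 k) ⟨
        ℤ.+ (2 * suc k)                      ∎
        where
        open ℤ.≤-Reasoning
        split : ∀ x y z → x ℤ.- z ≡ (x ℤ.- y) ℤ.+ (y ℤ.- z)
        split = solve-∀

      Φ-geodesic : AllSteps (OnGeodesic s e) p → Φ e ℤ.- Φ s ≡ ℤ.+ (2 * countSteps inPart p)
      Φ-geodesic on = begin
        Φ e ℤ.- Φ s
          ≡⟨ sumSteps-- (selectedGap e) (selectedGap s) p ⟨
        sumSteps (λ x y → selectedGap e x y ℤ.- selectedGap s x y) p
          ≡⟨ sumSteps-cong p (AllSteps-map selected-step p on) ⟩
        sumSteps (λ x y → if inPart x y then ℤ.+ 2 else 0ℤ) p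
          ≡⟨ sumSteps-indicator inPart 2 p ⟩
        ℤ.+ (2 * countSteps inPart p)
          ∎
        where
        open ≡-Reasoning
        selected-step : ∀ {x y} → T (adj G x y) → OnGeodesic s e x y →
          selectedGap e x y ℤ.- selectedGap s x y ≡ (if inPart x y then ℤ.+ 2 else 0ℤ)
        selected-step {x} {y} xy on-xy with inPart x y
        ... | true  = gap-geodesic xy on-xy
        ... | false = refl

    countSteps-≤-quotDist : ∀ {k s e} (p : Walk≤ k s e) → AllSteps (OnGeodesic s e) p →
                            countSteps inPart p ≤ quotDist G part i s e
    countSteps-≤-quotDist {s = s} {e} p on = *-cancelˡ-≤ 2 (ℤ.drop‿+≤+ (begin
      ℤ.+ (2 * countSteps inPart p)        ≡⟨ Φ-geodesic on ⟨
      Φ e ℤ.- Φ s                          ≤⟨ Φ-quotWalk (QuotU.shortest-walk (project p)) ⟩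
      ℤ.+ (2 * quotDist G part i s e)      ∎))
      where
      open Potential p
      open ℤ.≤-Reasoning

    quotDist-sym : ∀ x y → quotDist G part i x y ≡ quotDist G part i y x
    quotDist-sym x y = QuotU.distW-sym (project (proj₂ (walk x y)))

    quotDist-respˡ : ∀ {x u v} → T (same x u) → quotDist G part i x v ≡ quotDist G part i u v
    quotDist-respˡ {u = u} {v} xu = QuotU.distW-respˡ xu (project (proj₂ (walk u v)))

    quotDist-respʳ : ∀ {u y v} → T (same y v) → quotDist G part i u y ≡ quotDist G part i u v
    quotDist-respʳ {u} {y} {v} yv =
      trans (quotDist-sym u y) (trans (quotDist-respˡ yv) (quotDist-sym v u))

    open Classes same same-refl same-sym same-trans

    sumPairs-degree-quotDist : sumPairs (λ u v → (deg G u + deg G v) * quotDist G part i u v) ≡ Wquot G part i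
    sumPairs-degree-quotDist =
      sumPairs-cong-sumFin² degree-term W-term degree-term-sym degree-term-diag W-term-sym W-term-diag (begin
        sumFin (λ u → sumFin (λ v → (deg G u + deg G v) * quotDist G part i u v))
          ≡⟨ sumFin-cong (λ u → sumFin-cong (λ v → cong (_* quotDist G part i u v)
               (cong₂ _+_ (sym (*-identityʳ (deg G u))) (sym (*-identityʳ (deg G v)))))) ⟩
        sumFin (λ u → sumFin (λ v → (deg G u * 1 + deg G v * 1) * quotDist G part i u v))
          ≡⟨ sumFin²-byClass-sym (deg G) (λ _ → 1) (quotDist G part i) quotDist-respˡ quotDist-respʳ ⟩
        sumFin (λ x → sumFin (W-term x))
          ∎)
      where
      open ≡-Reasoning
      degree-term W-term : Fin n → Fin n → ℕ
      degree-term u v = (deg G u + deg G v) * quotDist G part i u v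
      W-term x y = when (isLeast x ∧ isLeast y)
        ((aW G part i x * bW G part i y + aW G part i y * bW G part i x) * quotDist G part i x y)
      degree-term-sym : ∀ u v → degree-term u v ≡ degree-term v u
      degree-term-sym u v = cong₂ _*_ (+-comm (deg G u) (deg G v)) (quotDist-sym u v)
      degree-term-diag : ∀ u → degree-term u u ≡ 0
      degree-term-diag u = trans (cong ((deg G u + deg G u) *_) (QuotU.distW-refl u)) (*-zeroʳ (deg G u + deg G u))
      W-term-sym : ∀ x y → W-term x y ≡ W-term y x
      W-term-sym x y = cong₂ when (∧-comm (isLeast x) (isLeast y))
        (cong₂ _*_ (+-comm (aW G part i x * bW G part i y) _) (quotDist-sym x y))
      W-term-diag : ∀ x → W-term x x ≡ 0
      W-term-diag x = trans (cong (when (isLeast x ∧ isLeast x))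
                                  (trans (cong (weight *_) (QuotU.distW-refl x)) (*-zeroʳ weight)))
                            (when-0 (isLeast x ∧ isLeast x))
        where
        weight : ℕ
        weight = aW G part i x * bW G part i x + aW G part i x * bW G part i x

  dist≡sumFin-quotDist : ∀ u v → d u v ≡ sumFin (λ i → quotDist G part i u v)
  dist≡sumFin-quotDist u v with geodesic u v
  ... | p , length≡d , on = begin
    d u v                                                  ≡⟨ length≡d ⟨
    length p                                               ≡⟨ sumFin-countSteps part p ⟨
    sumFin (λ i → countSteps (λ x y → eqᵇ (part x y) i) p) ≡⟨ sumFin-cong quotDist≡countSteps ⟨
    sumFin (λ i → quotDist G part i u v)                   ∎
    where
    open ≡-Reasoning
    quotDist≡countSteps : ∀ i → quotDist G part i u v ≡ countSteps (λ x y → eqᵇ (part x y) i) p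
    quotDist≡countSteps i =
      ≤-antisym (Quotient.quotDist-≤-countSteps i p) (Quotient.countSteps-≤-quotDist i p on)

mainTheorem3 : ∀ {n : ℕ} (G : Graph n) → Connected G →
    ∀ (r : ℕ) (part : Fin n → Fin n → Fin r) →
    (∀ u v → part u v ≡ part v u) →
    (∀ i → ∃ λ (e : Edge G) → part (proj₁ (proj₁ e)) (proj₂ (proj₁ e)) ≡ i) →
    (∀ (e f : Edge G) → Θ* G e f →
      part (proj₁ (proj₁ e)) (proj₂ (proj₁ e)) ≡
      part (proj₁ (proj₁ f)) (proj₂ (proj₁ f))) →
    DD G ≡ sumFin (Wquot G part)
mainTheorem3 G connected r part part-sym _ coarse = begin
  DD G
    ≡⟨ sumPairs-cong (λ u v → cong ((deg G u + deg G v) *_) (dist≡sumFin-quotDist u v)) ⟩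
  sumPairs (λ u v → (deg G u + deg G v) * sumFin (λ i → quotDist G part i u v))
    ≡⟨ sumPairs-cong (λ u v → sumFin-*ˡ (deg G u + deg G v) (λ i → quotDist G part i u v)) ⟨
  sumPairs (λ u v → sumFin (λ i → (deg G u + deg G v) * quotDist G part i u v))
    ≡⟨ sumPairs-sumFin (λ i u v → (deg G u + deg G v) * quotDist G part i u v) ⟩
  sumFin (λ i → sumPairs (λ u v → (deg G u + deg G v) * quotDist G part i u v))
    ≡⟨ sumFin-cong (λ i → Quotient.sumPairs-degree-quotDist i) ⟩
  sumFin (Wquot G part)
    ∎
  where
  open EdgePartition G connected part part-sym coarse
  open ≡-Reasoning
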